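{- For any integer $k\ge 1$ there exists a tournament $T$ with $\mu(T)\ge k$. Specifically, if $q$ is a prime power with $q\equiv 3\pmod 4$ and $q>4k-5$, then $\mu(P_q)\ge k$.
   Context: A tournament is a digraph in which for every pair of distinct vertices $u,v$ exactly one of the arcs $(u,v)$, $(v,u)$ is present. For a prime power $q\equiv 3\pmod 4$, the Paley tournament $P_q$ has vertex set the finite field $\mathbb{F}_q$ and an arc $(u,v)$ if and only if $v-u$ is a nonzero square in $\mathbb{F}_q$. A shortest directed $x,y$-path is a directed path (distinct vertices) from $x$ to $y$ of minimum length. A set $S$ of vertices of a digraph is a mutual-visibility set if for all distinct $x,y\in S$ there exist a shortest directed $x,y$-path $P$ and a shortest directed $y,x$-path $Q$ such that $(S\cap V(P))\cup(S\cap V(Q))=\{x,y\}$; $\mu$ denotes the maximum size of a mutual-visibility set. -}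

module Defs where

open import Level using (0ℓ)
open import Data.Nat using (ℕ; _≤_; _∸_)
open import Data.Fin using (Fin)
open import Data.List using (List; []; _∷_; length)
open import Data.List.Membership.Propositional using (_∈_)
open import Data.List.Relation.Unary.Unique.Propositional using (Unique)
open import Data.Product using (Σ; ∃; ∃-syntax; _×_)
open import Data.Sum using (_⊎_)
open import Relation.Nullary using (¬_)
open import Relation.Binary.PropositionalEquality using (_≡_; _≢_)
open import Algebra.Structures using (IsCommutativeRing)
open import Function.Bundles using (_↔_)

module _ {V : Set} (Arc : V → V → Set) where

  IsTournament : Set
  IsTournament =
    (∀ v → ¬ Arc v v) ×
    (∀ u v → u ≢ v → (Arc u v × ¬ Arc v u) ⊎ (Arc v u × ¬ Arc u v))

  data Walk : V → V → List V → Set where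
    here : ∀ {x} → Walk x x (x ∷ [])
    step : ∀ {x y z p} → Arc x y → Walk y z p → Walk x z (x ∷ p)

  IsPath : V → V → List V → Set
  IsPath x y p = Walk x y p × Unique p

  pathLength : List V → ℕ
  pathLength p = length p ∸ 1

  IsShortestPath : V → V → List V → Set
  IsShortestPath x y p =
    IsPath x y p × (∀ p′ → IsPath x y p′ → pathLength p ≤ pathLength p′)

  IsMutualVisibilitySet : List V → Set
  IsMutualVisibilitySet S =
    Unique S ×
    (∀ x y → x ∈ S → y ∈ S → x ≢ y →
      Σ (List V) λ P → Σ (List V) λ Q →
        IsShortestPath x y P × IsShortestPath y x Q ×
        (∀ z → z ∈ S → (z ∈ P ⊎ z ∈ Q) → (z ≡ x ⊎ z ≡ y)))

  μ≥ : ℕ → Set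
  μ≥ k = Σ (List V) λ S → IsMutualVisibilitySet S × k ≤ length S

record FiniteField (q : ℕ) : Set₁ where
  infixl 6 _+_
  infixl 7 _*_
  field
    Carrier : Set
    _+_ _*_ : Carrier → Carrier → Carrier
    -_      : Carrier → Carrier
    0# 1#   : Carrier
    isCommutativeRing : IsCommutativeRing _≡_ _+_ _*_ -_ 0# 1#
    1≢0     : 1# ≢ 0#
    inverse : ∀ x → x ≢ 0# → ∃[ y ] (x * y ≡ 1#)
    enumeration : Fin q ↔ Carrier

  _-_ : Carrier → Carrier → Carrier
  x - y = x + (- y)

PaleyArc : ∀ {q} (F : FiniteField q) → FiniteField.Carrier F → FiniteField.Carrier F → Set
PaleyArc F u v = (v - u ≢ 0#) × ∃[ w ] (w * w ≡ v - u)
  where open FiniteField F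

{-# OPTIONS --safe #-}
-- Let q = 4t + 3. Then -1 is a non-square in F_q, so exactly one of v - u, u - v is a nonzero
-- square and P_q is a tournament. The maps z ↦ x + d z with d a nonzero square are automorphisms
-- of P_q, so every arc x → y has as many return vertices z (with y → z → x) as the arc 0 → 1,
-- and counting consecutive quadratic residues shows that there are t + 1 of them. Hence when
-- |S| ≤ t + 1 some return vertex lies outside S, and x → y, y → z → x are shortest paths that
-- meet S only in x and y. The existence part needs no field: add to a transitive tournament on
-- k vertices two vertices 0 → 1, with every old vertex → 0 and 1 → every old vertex; then the
-- paths y → 0 → 1 → x play the same role.
module Submission where

open import Level using (0ℓ)
open import Algebra.Bundles using (CommutativeRing)
import Algebra.Properties.Ring as RingProperties
import Algebra.Properties.CommutativeSemigroup as CommutativeSemigroupProperties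
open import Data.Fin as Fin using (Fin; zero; suc)
open import Data.List using (List; []; _∷_; length; filter; map; tabulate; take)
open import Data.List.Properties using (length-map; length-tabulate; length-take; filter-notAll; filter-some; filter-none; filter-all)
open import Data.List.Membership.Propositional using (_∈_; _∉_; lose)
open import Data.List.Membership.Propositional.Properties using (∈-filter⁺; ∈-filter⁻; ∈-map⁻; ∈-tabulate⁺; ∈-tabulate⁻)
open import Data.List.Relation.Unary.Any as Any using (Any; here; there; any?; satisfied)
open import Data.List.Relation.Unary.All as All using (All; []; _∷_)
open import Data.List.Relation.Unary.All.Properties using (all-filter; map⁺)
import Data.Fin.Properties as Finₚ
open import Data.List.Relation.Unary.AllPairs using ([]; _∷_)
open import Data.List.Relation.Unary.Unique.Propositional using (Unique)
open import Data.List.Relation.Unary.Unique.Propositional.Properties using (tabulate⁺; filter⁺; take⁺)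
import Data.Nat as Nat
open Nat using (ℕ; zero; suc; _≤_; _<_; z≤n; s≤s)
open import Data.Nat.Properties using (module ≤-Reasoning; ≤-reflexive; ≤-trans; ≤-antisym; ≤-pred; <-asym; <-irrefl; ≮⇒≥; ≤∧≢⇒<; m<n+m; m≤n*m; m≤n⇒m⊓n≡m)
open import Data.Nat.Properties using (suc-injective; +-comm; +-suc; +-identityʳ; *-comm; +-monoʳ-≤; +-cancelˡ-≡; +-cancelˡ-<; *-cancelˡ-≡; *-cancelˡ-<; even≢odd)
open import Data.Nat.Tactic.RingSolver using (solve-∀)
open import Data.Nat.DivMod using (m≡m%n+[m/n]*n)
open import Data.Product using (Σ; ∃; ∃-syntax; _×_; _,_; proj₁; proj₂)
open import Data.Sum using (_⊎_; inj₁; inj₂; swap)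
open import Data.Unit using (⊤; tt)
open import Data.Empty using (⊥)
open import Function using (_∘_; case_of_)
open import Function.Bundles using (_↔_; Inverse)
open import Relation.Binary.Definitions using (DecidableEquality; tri<; tri≈; tri>)
open import Relation.Binary.PropositionalEquality using (_≡_; _≢_; refl; sym; trans; cong; cong₂; subst; module ≡-Reasoning)
open import Relation.Nullary using (¬_; Dec; yes; no; contradiction)
open import Relation.Nullary.Decidable using (map′; ¬?; _×-dec_)
open import Relation.Unary using (Pred; Decidable; _⊆_; _≐_; _∩_; ∁; U)
open import Relation.Unary.Properties using (_∩?_; ∁?; U?)
open import Defs

module _ {A : Set} (_≟_ : DecidableEquality A) where

  length-mono-⊆ : ∀ {xs ys : List A} → Unique xs → (∀ {z} → z ∈ xs → z ∈ ys) → length xs ≤ length ys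
  length-mono-⊆ {[]} _ _ = z≤n
  length-mono-⊆ {x ∷ xs} {ys} (x∉xs ∷ xs-unique) x∷xs⊆ys = begin-strict
    length xs                        ≤⟨ length-mono-⊆ xs-unique xs⊆ys-x ⟩
    length (filter (¬? ∘ (_≟ x)) ys) <⟨ filter-notAll (¬? ∘ (_≟ x)) ys x∈ys ⟩
    length ys                        ∎
    where
    open ≤-Reasoning
    x∈ys = Any.map (λ x≡z z≢x → z≢x (sym x≡z)) (x∷xs⊆ys (here refl))
    xs⊆ys-x : ∀ {z} → z ∈ xs → z ∈ filter (¬? ∘ (_≟ x)) ys
    xs⊆ys-x z∈xs = ∈-filter⁺ (¬? ∘ (_≟ x)) (x∷xs⊆ys (there z∈xs)) (λ z≡x → All.lookup x∉xs z∈xs (sym z≡x))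

map-injectiveOn⁺ : ∀ {A B : Set} {P : Pred A 0ℓ} {f : A → B} {xs} →
  (∀ {x y} → P x → P y → f x ≡ f y → x ≡ y) → All P xs → Unique xs → Unique (map f xs)
map-injectiveOn⁺ f-inj [] [] = []
map-injectiveOn⁺ {f = f} f-inj (px ∷ pxs) (x∉xs ∷ xs-unique) =
  map⁺ (All.zipWith (λ (x≢y , py) fx≡fy → x≢y (f-inj px py fx≡fy)) (x∉xs , pxs)) ∷ map-injectiveOn⁺ f-inj pxs xs-unique

module FiniteCounting {A : Set} {n : ℕ} (enumeration : Fin n ↔ A) where
  open Nat using (_+_; _*_)
  open Inverse enumeration using (to; from; strictlyInverseˡ; strictlyInverseʳ)

  private variable
    P R : Pred A 0ℓ

  from-injective : ∀ {x y} → from x ≡ from y → x ≡ y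
  from-injective {x} {y} eq = trans (sym (strictlyInverseˡ x)) (trans (cong to eq) (strictlyInverseˡ y))

  infix 4 _≟_
  _≟_ : DecidableEquality A
  x ≟ y = map′ from-injective (cong from) (from x Fin.≟ from y)

  elements : List A
  elements = tabulate to

  elements-unique : Unique elements
  elements-unique = tabulate⁺ λ {i} {j} eq → trans (sym (strictlyInverseʳ i)) (trans (cong from eq) (strictlyInverseʳ j))

  ∈-elements : ∀ x → x ∈ elements
  ∈-elements x = subst (_∈ elements) (strictlyInverseˡ x) (∈-tabulate⁺ (from x))

  length-elements : length elements ≡ n
  length-elements = length-tabulate to

  from-<-flip : ∀ {x y} → x ≢ y → ¬ (from x Fin.< from y) → from y Fin.< from x
  from-<-flip x≢y x≮y = ≤∧≢⇒< (≮⇒≥ x≮y) (x≢y ∘ sym ∘ from-injective ∘ Finₚ.toℕ-injective)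

  Precedes : (A → A) → Pred A 0ℓ
  Precedes σ x = from x Fin.< from (σ x)

  precedes? : (σ : A → A) → Decidable (Precedes σ)
  precedes? σ x = from x Fin.<? from (σ x)

  ∃? : Decidable P → Dec (∃ P)
  ∃? P? = map′ satisfied (λ (x , px) → lose (∈-elements x) px) (any? P? elements)

  count : Decidable P → ℕ
  count P? = length (filter P? elements)

  count-all : count U? ≡ n
  count-all = trans (cong length (filter-all U? (All.universal (λ _ → tt) elements))) length-elements

  count>0 : (P? : Decidable P) {x : A} → P x → 0 < count P?
  count>0 P? {x} px = filter-some P? (lose (∈-elements x) px)

  count>0⇒∃ : (P? : Decidable P) → 0 < count P? → ∃ P
  count>0⇒∃ P? pos with ∃? P?
  ... | yes ∃P = ∃P
  ... | no ¬∃P = contradiction (subst (0 <_) (cong length (filter-none P? none)) pos) λ ()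
    where
    none = All.universal (λ x px → ¬∃P (x , px)) elements

  count-≤-length : (P? : Decidable P) {ys : List A} → P ⊆ (_∈ ys) → count P? ≤ length ys
  count-≤-length P? P⊆ys = length-mono-⊆ _≟_ (filter⁺ P? elements-unique) (P⊆ys ∘ proj₂ ∘ ∈-filter⁻ P? {xs = elements})

  count-≤-injection : (P? : Decidable P) (R? : Decidable R) (f : A → A) →
    (∀ {x} → P x → R (f x)) → (∀ {x y} → P x → P y → f x ≡ f y → x ≡ y) → count P? ≤ count R?
  count-≤-injection P? R? f f-maps f-inj = begin
    count P?                            ≡⟨ length-map f (filter P? elements) ⟨
    length (map f (filter P? elements)) ≤⟨ length-mono-⊆ _≟_ image-unique image⊆ ⟩
    count R?                            ∎
    where
    open ≤-Reasoning
    image-unique = map-injectiveOn⁺ f-inj (all-filter P? elements) (filter⁺ P? elements-unique)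
    image⊆ : ∀ {z} → z ∈ map f (filter P? elements) → z ∈ filter R? elements
    image⊆ z∈ with x , x∈ , refl ← ∈-map⁻ f z∈ =
      ∈-filter⁺ R? (∈-elements (f x)) (f-maps (proj₂ (∈-filter⁻ P? {xs = elements} x∈)))

  count-mono : (P? : Decidable P) (R? : Decidable R) → P ⊆ R → count P? ≤ count R?
  count-mono P? R? P⊆R = count-≤-injection P? R? (λ x → x) P⊆R (λ _ _ eq → eq)

  count-cong : (P? : Decidable P) (R? : Decidable R) → P ≐ R → count P? ≡ count R?
  count-cong P? R? (P⊆R , R⊆P) = ≤-antisym (count-mono P? R? P⊆R) (count-mono R? P? R⊆P)

  count-singleton : (P? : Decidable P) (a : A) → P ≐ (_≡ a) → count P? ≡ 1
  count-singleton P? a (P⊆a , a⊆P) = ≤-antisym (count-≤-length P? {a ∷ []} (here ∘ P⊆a)) (count>0 P? (a⊆P refl))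

  count-split : (P? : Decidable P) (R? : Decidable R) → count P? ≡ count (P? ∩? R?) + count (P? ∩? ∁? R?)
  count-split P? R? = go elements
    where
    go : ∀ xs → length (filter P? xs) ≡ length (filter (P? ∩? R?) xs) + length (filter (P? ∩? ∁? R?) xs)
    go [] = refl
    go (x ∷ xs) with P? x | R? x
    ... | yes _ | yes _ = cong suc (go xs)
    ... | yes _ | no _  = trans (cong suc (go xs)) (sym (+-suc _ _))
    ... | no _  | _     = go xs

  count-involution : {P : Pred A 0ℓ} (P? : Decidable P) (σ : A → A) → (∀ {x} → P x → P (σ x)) → (∀ x → σ (σ x) ≡ x) →
    (∀ {x} → P x → σ x ≢ x) → count P? ≡ 2 * count (P? ∩? precedes? σ)
  count-involution {P} P? σ σ-maps σ-involutive σ-fixpointFree = begin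
    count P?         ≡⟨ count-split P? below? ⟩
    h + count (P? ∩? ∁? below?) ≡⟨ cong (h +_) (≤-antisym (count-≤-injection _ _ σ above⇒below (λ _ _ → σ-injective))
                                                       (count-≤-injection _ _ σ below⇒above (λ _ _ → σ-injective))) ⟩
    h + h            ≡⟨ cong (h +_) (+-identityʳ h) ⟨
    2 * h            ∎
    where
    open ≡-Reasoning
    Below = Precedes σ
    below? = precedes? σ
    h = count (P? ∩? below?)
    σ-injective : ∀ {x y} → σ x ≡ σ y → x ≡ y
    σ-injective {x} {y} eq = trans (sym (σ-involutive x)) (trans (cong σ eq) (σ-involutive y))
    above⇒below : ∀ {x} → (P ∩ ∁ Below) x → (P ∩ Below) (σ x)
    above⇒below {x} (px , x≮σx) = σ-maps px , subst (λ y → from (σ x) Fin.< from y) (sym (σ-involutive x))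
      (from-<-flip (σ-fixpointFree px ∘ sym) x≮σx)
    below⇒above : ∀ {x} → (P ∩ Below) x → (P ∩ ∁ Below) (σ x)
    below⇒above {x} (px , x<σx) = σ-maps px , λ σx<x → <-asym x<σx (subst (λ y → from (σ x) Fin.< from y) (σ-involutive x) σx<x)

  count-∘-bijection : (P? : Decidable P) (g h : A → A) → (∀ x → g (h x) ≡ x) → (∀ x → h (g x) ≡ x) →
    count (P? ∘ g) ≡ count P?
  count-∘-bijection {P} P? g h g∘h h∘g = ≤-antisym
    (count-≤-injection (P? ∘ g) P? g (λ pgx → pgx) (λ _ _ → g-injective))
    (count-≤-injection P? (P? ∘ g) h (λ {x} px → subst P (sym (g∘h x)) px) (λ _ _ → h-injective))
    where
    g-injective : ∀ {x y} → g x ≡ g y → x ≡ y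
    g-injective {x} {y} eq = trans (sym (h∘g x)) (trans (cong h eq) (h∘g y))
    h-injective : ∀ {x y} → h x ≡ h y → x ≡ y
    h-injective {x} {y} eq = trans (sym (g∘h x)) (trans (cong g eq) (g∘h y))

  injection-onto : (P? : Decidable P) (R? : Decidable R) (f : A → A) →
    (∀ {x} → P x → R (f x)) → (∀ {x y} → P x → P y → f x ≡ f y → x ≡ y) → count R? ≤ count P? →
    ∀ {y} → R y → ∃[ x ] (P x × f x ≡ y)
  injection-onto {P} {R} P? R? f f-maps f-inj R≤P {y} ry with ∃? (λ x → P? x ×-dec (f x ≟ y))
  ... | yes hit = hit
  ... | no miss = contradiction (begin-strict
      count P?                           ≤⟨ count-≤-injection P? (R? ∩? ∁? (_≟ y)) f maps-off-y f-inj ⟩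
      count (R? ∩? ∁? (_≟ y))            <⟨ m<n+m _ (count>0 (R? ∩? (_≟ y)) (ry , refl)) ⟩
      count (R? ∩? (_≟ y)) + count (R? ∩? ∁? (_≟ y)) ≡⟨ count-split R? (_≟ y) ⟨
      count R?                           ≤⟨ R≤P ⟩
      count P?                           ∎) (<-irrefl refl)
    where
    open ≤-Reasoning
    maps-off-y : ∀ {x} → P x → (R ∩ ∁ (_≡ y)) (f x)
    maps-off-y px = f-maps px , λ fx≡y → miss (_ , px , fx≡y)

module Visibility {V : Set} (Arc : V → V → Set) where

  private variable
    x y a b : V
    p : List V
    S : List V

  VisiblePair : List V → V → V → Set
  VisiblePair S x y = Σ (List V) λ P → Σ (List V) λ Q →
    IsShortestPath Arc x y P × IsShortestPath Arc y x Q × (∀ z → z ∈ S → (z ∈ P ⊎ z ∈ Q) → (z ≡ x ⊎ z ≡ y))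

  VisiblePair-sym : VisiblePair S y x → VisiblePair S x y
  VisiblePair-sym (P , Q , P-shortest , Q-shortest , avoids) = Q , P , Q-shortest , P-shortest , λ z z∈S → swap ∘ avoids z z∈S ∘ swap

  private
    walk-nonempty : Walk Arc x y p → 1 ≤ length p
    walk-nonempty here       = s≤s z≤n
    walk-nonempty (step _ _) = s≤s z≤n

  1≤pathLength : x ≢ y → Walk Arc x y p → 1 ≤ pathLength Arc p
  1≤pathLength x≢y here       = contradiction refl x≢y
  1≤pathLength x≢y (step _ w) = walk-nonempty w

  2≤pathLength : x ≢ y → ¬ Arc x y → Walk Arc x y p → 2 ≤ pathLength Arc p
  2≤pathLength x≢y ¬x→y here                = contradiction refl x≢y
  2≤pathLength x≢y ¬x→y (step x→y here)     = contradiction x→y ¬x→y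
  2≤pathLength x≢y ¬x→y (step _ (step _ w)) = s≤s (walk-nonempty w)

  3≤pathLength : x ≢ y → ¬ Arc x y → (∀ c → Arc x c → ¬ Arc c y) → Walk Arc x y p → 3 ≤ pathLength Arc p
  3≤pathLength x≢y ¬x→y no-2-path here                        = contradiction refl x≢y
  3≤pathLength x≢y ¬x→y no-2-path (step x→y here)             = contradiction x→y ¬x→y
  3≤pathLength x≢y ¬x→y no-2-path (step x→c (step c→y here))  = contradiction c→y (no-2-path _ x→c)
  3≤pathLength x≢y ¬x→y no-2-path (step _ (step _ (step _ w))) = s≤s (s≤s (walk-nonempty w))

  module _ (tournament : IsTournament Arc) where
    private
      Arc⇒≢ : Arc x y → x ≢ y
      Arc⇒≢ x→y refl = proj₁ tournament _ x→y

      Arc-asym : Arc x y → ¬ Arc y x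
      Arc-asym {x} {y} x→y with proj₂ tournament x y (Arc⇒≢ x→y)
      ... | inj₁ (_ , ¬y→x) = ¬y→x
      ... | inj₂ (_ , ¬x→y) = contradiction x→y ¬x→y

      arc-shortest : Arc x y → IsShortestPath Arc x y (x ∷ y ∷ [])
      arc-shortest x→y = (step x→y here , (Arc⇒≢ x→y ∷ []) ∷ [] ∷ []) , λ _ (walk , _) → 1≤pathLength (Arc⇒≢ x→y) walk

    visible-via-2-path : Arc x y → Arc y a → Arc a x → a ∉ S → VisiblePair S x y
    visible-via-2-path {x} {y} {a} {S} x→y y→a a→x a∉S =
      x ∷ y ∷ [] , y ∷ a ∷ x ∷ [] , arc-shortest x→y , return-shortest , avoids
      where
      y≢x = Arc⇒≢ x→y ∘ sym
      return-shortest : IsShortestPath Arc y x (y ∷ a ∷ x ∷ [])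
      return-shortest = (step y→a (step a→x here) , (Arc⇒≢ y→a ∷ y≢x ∷ []) ∷ (Arc⇒≢ a→x ∷ []) ∷ [] ∷ []) ,
                        λ _ (walk , _) → 2≤pathLength y≢x (Arc-asym x→y) walk
      avoids : ∀ z → z ∈ S → (z ∈ x ∷ y ∷ [] ⊎ z ∈ y ∷ a ∷ x ∷ []) → (z ≡ x ⊎ z ≡ y)
      avoids z _   (inj₁ (here z≡x))                 = inj₁ z≡x
      avoids z _   (inj₁ (there (here z≡y)))         = inj₂ z≡y
      avoids z _   (inj₂ (here z≡y))                 = inj₂ z≡y
      avoids z z∈S (inj₂ (there (here refl)))        = contradiction z∈S a∉S
      avoids z _   (inj₂ (there (there (here z≡x)))) = inj₁ z≡x

    visible-via-3-path : Arc x y → (∀ c → Arc y c → ¬ Arc c x) → Arc y a → Arc a b → Arc b x → a ∉ S → b ∉ S →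
      VisiblePair S x y
    visible-via-3-path {x} {y} {a} {b} {S} x→y no-2-path y→a a→b b→x a∉S b∉S =
      x ∷ y ∷ [] , y ∷ a ∷ b ∷ x ∷ [] , arc-shortest x→y , return-shortest , avoids
      where
      y≢x = Arc⇒≢ x→y ∘ sym
      return-unique : Unique (y ∷ a ∷ b ∷ x ∷ [])
      return-unique = (Arc⇒≢ y→a ∷ (λ { refl → Arc-asym x→y b→x }) ∷ y≢x ∷ [])
                    ∷ (Arc⇒≢ a→b ∷ (λ { refl → Arc-asym x→y y→a }) ∷ [])
                    ∷ (Arc⇒≢ b→x ∷ []) ∷ [] ∷ []
      return-shortest : IsShortestPath Arc y x (y ∷ a ∷ b ∷ x ∷ [])
      return-shortest = (step y→a (step a→b (step b→x here)) , return-unique) ,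
                        λ _ (walk , _) → 3≤pathLength y≢x (Arc-asym x→y) no-2-path walk
      avoids : ∀ z → z ∈ S → (z ∈ x ∷ y ∷ [] ⊎ z ∈ y ∷ a ∷ b ∷ x ∷ []) → (z ≡ x ⊎ z ≡ y)
      avoids z _   (inj₁ (here z≡x))                         = inj₁ z≡x
      avoids z _   (inj₁ (there (here z≡y)))                 = inj₂ z≡y
      avoids z _   (inj₂ (here z≡y))                         = inj₂ z≡y
      avoids z z∈S (inj₂ (there (here refl)))                = contradiction z∈S a∉S
      avoids z z∈S (inj₂ (there (there (here refl))))        = contradiction z∈S b∉S
      avoids z _   (inj₂ (there (there (there (here z≡x))))) = inj₁ z≡x

    isMutualVisibilitySet : Unique S → (∀ {x y} → x ∈ S → y ∈ S → Arc x y → VisiblePair S x y) →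
      IsMutualVisibilitySet Arc S
    isMutualVisibilitySet S-unique visible = S-unique , λ x y x∈S y∈S x≢y → case proj₂ tournament x y x≢y of λ where
      (inj₁ (x→y , _)) → visible x∈S y∈S x→y
      (inj₂ (y→x , _)) → VisiblePair-sym (visible y∈S x∈S y→x)

module TransitiveWithReturnPath (k : ℕ) where
  open Nat using (_+_)

  Arc : Fin (2 + k) → Fin (2 + k) → Set
  Arc zero          (suc zero)    = ⊤
  Arc (suc zero)    (suc (suc _)) = ⊤
  Arc (suc (suc _)) zero          = ⊤
  Arc (suc (suc i)) (suc (suc j)) = i Fin.< j
  Arc _             _             = ⊥

  open Visibility Arc

  inner : Fin k → Fin (2 + k)
  inner i = suc (suc i)

  isTournament : IsTournament Arc
  isTournament = irreflexive , total
    where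
    irreflexive : ∀ v → ¬ Arc v v
    irreflexive (suc (suc i)) i<i = Finₚ.<-irrefl refl i<i
    total : ∀ u v → u ≢ v → (Arc u v × ¬ Arc v u) ⊎ (Arc v u × ¬ Arc u v)
    total zero          zero          u≢v = contradiction refl u≢v
    total zero          (suc zero)    _   = inj₁ (tt , λ ())
    total zero          (suc (suc _)) _   = inj₂ (tt , λ ())
    total (suc zero)    zero          _   = inj₂ (tt , λ ())
    total (suc zero)    (suc zero)    u≢v = contradiction refl u≢v
    total (suc zero)    (suc (suc _)) _   = inj₁ (tt , λ ())
    total (suc (suc _)) zero          _   = inj₁ (tt , λ ())
    total (suc (suc _)) (suc zero)    _   = inj₂ (tt , λ ())
    total (suc (suc i)) (suc (suc j)) u≢v with Finₚ.<-cmp i j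
    ... | tri< i<j _ _ = inj₁ (i<j , Finₚ.<-asym i<j)
    ... | tri≈ _ i≡j _ = contradiction (cong inner i≡j) u≢v
    ... | tri> _ _ j<i = inj₂ (j<i , Finₚ.<-asym j<i)

  S : List (Fin (2 + k))
  S = tabulate inner

  zero∉S : zero ∉ S
  zero∉S z∈S with ∈-tabulate⁻ {f = inner} z∈S
  ... | _ , ()

  one∉S : suc zero ∉ S
  one∉S o∈S with ∈-tabulate⁻ {f = inner} o∈S
  ... | _ , ()

  visible : ∀ {x y} → x ∈ S → y ∈ S → Arc x y → VisiblePair S x y
  visible x∈S y∈S with ∈-tabulate⁻ {f = inner} x∈S | ∈-tabulate⁻ {f = inner} y∈S
  ... | i , refl | j , refl = λ i<j → visible-via-3-path isTournament i<j (no-2-path i<j) tt tt tt zero∉S one∉S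
    where
    no-2-path : ∀ {i j} → i Fin.< j → ∀ c → Arc (suc (suc j)) c → ¬ Arc c (suc (suc i))
    no-2-path i<j (suc (suc m)) j<m m<i = Finₚ.<-asym m<i (Finₚ.<-trans i<j j<m)

  μ≥k : μ≥ Arc k
  μ≥k = S , isMutualVisibilitySet isTournament (tabulate⁺ (Finₚ.suc-injective ∘ Finₚ.suc-injective)) visible ,
        ≤-reflexive (sym (length-tabulate inner))

module FiniteFieldProperties {q : ℕ} (F : FiniteField q) where
  open FiniteField F
  open FiniteCounting enumeration public

  commutativeRing : CommutativeRing 0ℓ 0ℓ
  commutativeRing = record { isCommutativeRing = isCommutativeRing }

  module R = CommutativeRing commutativeRing
  open RingProperties R.ring using (x∙y⁻¹≈ε⇒x≈y; +-inverseˡ-unique; -‿involutive; -0#≈0#; -‿distribˡ-*; [y-z]x≈yx-zx)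
  open CommutativeSemigroupProperties R.*-commutativeSemigroup using (interchange)

  private variable
    x y z w : Carrier

  -‿nonzero : x ≢ 0# → - x ≢ 0#
  -‿nonzero {x} x≢0 -x≡0 = x≢0 (trans (sym (-‿involutive x)) (trans (cong -_ -x≡0) -0#≈0#))

  x-y≡0⇒x≡y : x - y ≡ 0# → x ≡ y
  x-y≡0⇒x≡y = x∙y⁻¹≈ε⇒x≈y _ _

  -- The inverse of 0# is the junk value 0#.
  _⁻¹ : Carrier → Carrier
  x ⁻¹ with x ≟ 0#
  ... | yes _   = 0#
  ... | no x≢0 = proj₁ (inverse x x≢0)

  *-inverseʳ : x ≢ 0# → x * x ⁻¹ ≡ 1#
  *-inverseʳ {x} x≢0 with x ≟ 0#
  ... | yes x≡0 = contradiction x≡0 x≢0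
  ... | no x≢0  = proj₂ (inverse x x≢0)

  *-inverseˡ : x ≢ 0# → x ⁻¹ * x ≡ 1#
  *-inverseˡ {x} x≢0 = trans (R.*-comm (x ⁻¹) x) (*-inverseʳ x≢0)

  *-cancelˡ : x ≢ 0# → x * y ≡ x * z → y ≡ z
  *-cancelˡ {x} {y} {z} x≢0 xy≡xz = begin
    y              ≡⟨ R.*-identityˡ y ⟨
    1# * y         ≡⟨ cong (_* y) (*-inverseˡ x≢0) ⟨
    (x ⁻¹ * x) * y ≡⟨ R.*-assoc (x ⁻¹) x y ⟩
    x ⁻¹ * (x * y) ≡⟨ cong (x ⁻¹ *_) xy≡xz ⟩
    x ⁻¹ * (x * z) ≡⟨ R.*-assoc (x ⁻¹) x z ⟨
    (x ⁻¹ * x) * z ≡⟨ cong (_* z) (*-inverseˡ x≢0) ⟩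
    1# * z         ≡⟨ R.*-identityˡ z ⟩
    z              ∎
    where open ≡-Reasoning

  *-nonzero : x ≢ 0# → y ≢ 0# → x * y ≢ 0#
  *-nonzero {x} x≢0 y≢0 xy≡0 = y≢0 (*-cancelˡ x≢0 (trans xy≡0 (sym (R.zeroʳ x))))

  ⁻¹-nonzero : x ≢ 0# → x ⁻¹ ≢ 0#
  ⁻¹-nonzero {x} x≢0 x⁻¹≡0 = 1≢0 (trans (sym (*-inverseʳ x≢0)) (trans (cong (x *_) x⁻¹≡0) (R.zeroʳ x)))

  ⁻¹-injective : x ≢ 0# → y ≢ 0# → x ⁻¹ ≡ y ⁻¹ → x ≡ y
  ⁻¹-injective {x} {y} x≢0 y≢0 x⁻¹≡y⁻¹ =
    *-cancelˡ (⁻¹-nonzero x≢0) (trans (*-inverseˡ x≢0) (trans (sym (*-inverseˡ y≢0)) (cong (_* y) (sym x⁻¹≡y⁻¹))))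

  square-roots : x * x ≡ y * y → x ≡ y ⊎ x ≡ - y
  square-roots {x} {y} xx≡yy with (x - y) ≟ 0#
  ... | yes x-y≡0 = inj₁ (x-y≡0⇒x≡y x-y≡0)
  ... | no x-y≢0  = inj₂ (+-inverseˡ-unique x y (*-cancelˡ x-y≢0 (trans factored (sym (R.zeroʳ _)))))
    where
    open ≡-Reasoning
    factored : (x - y) * (x + y) ≡ 0#
    factored = begin
      (x - y) * (x + y)                 ≡⟨ [y-z]x≈yx-zx (x + y) x y ⟩
      (x * (x + y)) - (y * (x + y))     ≡⟨ cong₂ _-_ (R.distribˡ x x y) (R.distribˡ y x y) ⟩
      (x * x + x * y) - (y * x + y * y) ≡⟨ cong₂ (λ u v → (u + x * y) - (v + y * y)) xx≡yy (R.*-comm y x) ⟩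
      (y * y + x * y) - (x * y + y * y) ≡⟨ cong (_- (x * y + y * y)) (R.+-comm (y * y) (x * y)) ⟩
      (x * y + y * y) - (x * y + y * y) ≡⟨ R.-‿inverseʳ _ ⟩
      0#                                ∎

  IsSquare : Pred Carrier 0ℓ
  IsSquare x = ∃[ w ] w * w ≡ x

  isSquare? : Decidable IsSquare
  isSquare? x = ∃? (λ w → w * w ≟ x)

  -- Nonzero squares; PaleyArc F u v is literally QR (v - u).
  QR : Pred Carrier 0ℓ
  QR x = x ≢ 0# × IsSquare x

  QR? : Decidable QR
  QR? = ∁? (_≟ 0#) ∩? isSquare?

  QR-1 : QR 1#
  QR-1 = 1≢0 , 1# , R.*-identityˡ 1#

  QR-square : w ≢ 0# → QR (w * w)
  QR-square w≢0 = *-nonzero w≢0 w≢0 , _ , refl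

  QR-* : QR x → QR y → QR (x * y)
  QR-* (x≢0 , u , uu≡x) (y≢0 , v , vv≡y) = *-nonzero x≢0 y≢0 , u * v , trans (interchange u v u v) (cong₂ _*_ uu≡x vv≡y)

  QR-⁻¹ : QR x → QR (x ⁻¹)
  QR-⁻¹ {x} qx@(x≢0 , _) = subst QR x[x⁻¹x⁻¹]≡x⁻¹ (QR-* qx (QR-square (⁻¹-nonzero x≢0)))
    where
    x[x⁻¹x⁻¹]≡x⁻¹ : x * (x ⁻¹ * x ⁻¹) ≡ x ⁻¹
    x[x⁻¹x⁻¹]≡x⁻¹ = trans (sym (R.*-assoc x (x ⁻¹) (x ⁻¹)))
                          (trans (cong (_* x ⁻¹) (*-inverseʳ x≢0)) (R.*-identityˡ (x ⁻¹)))

module OddOrder {q : ℕ} (F : FiniteField q) (m : ℕ) (q≡1+2m : q ≡ suc (2 Nat.* m)) where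
  open FiniteField F
  open FiniteFieldProperties F
  open Inverse enumeration using (from)
  open RingProperties R.ring using (+-cancelˡ; -‿involutive; -‿distribˡ-*; -‿distribʳ-*)

  private variable
    x y w : Carrier

  1+1≢0 : 1# + 1# ≢ 0#
  1+1≢0 1+1≡0 = even≢odd (count (U? ∩? precedes? (_+ 1#))) m
    (trans (sym (count-involution U? (_+ 1#) (λ _ → tt) +1+1≡id +1≢id)) (trans count-all q≡1+2m))
    where
    +1+1≡id : ∀ x → (x + 1#) + 1# ≡ x
    +1+1≡id x = trans (R.+-assoc x 1# 1#) (trans (cong (x +_) 1+1≡0) (R.+-identityʳ x))
    +1≢id : ∀ {x} → U x → x + 1# ≢ x
    +1≢id {x} _ x+1≡x = 1≢0 (+-cancelˡ x 1# 0# (trans x+1≡x (sym (R.+-identityʳ x))))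

  -x≢x : x ≢ 0# → - x ≢ x
  -x≢x {x} x≢0 -x≡x = 1+1≢0 (*-cancelˡ x≢0 (begin
    x * (1# + 1#)   ≡⟨ R.distribˡ x 1# 1# ⟩
    x * 1# + x * 1# ≡⟨ cong₂ _+_ (R.*-identityʳ x) (R.*-identityʳ x) ⟩
    x + x           ≡⟨ cong (x +_) -x≡x ⟨
    x + - x         ≡⟨ R.-‿inverseʳ x ⟩
    0#              ≡⟨ R.zeroʳ x ⟨
    x * 0#          ∎))
    where open ≡-Reasoning

  nonzero? : Decidable (∁ (_≡ 0#))
  nonzero? = ∁? (_≟ 0#)

  q≡1+count-nonzero : q ≡ suc (count nonzero?)
  q≡1+count-nonzero = begin
    q                                                  ≡⟨ count-all ⟨
    count U?                                           ≡⟨ count-split U? (_≟ 0#) ⟩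
    count (U? ∩? (_≟ 0#)) Nat.+ count (U? ∩? nonzero?) ≡⟨ cong₂ Nat._+_ (count-singleton _ 0# (proj₂ , (tt ,_)))
                                                                        (count-cong _ nonzero? (proj₂ , (tt ,_))) ⟩
    suc (count nonzero?)                               ∎
    where open ≡-Reasoning

  Canonical : Pred Carrier 0ℓ
  Canonical = Precedes (-_)

  canonical? : Decidable Canonical
  canonical? = precedes? (-_)

  -- The enumeration order picks one representative out of each pair ±w.
  canonical : Carrier → Carrier
  canonical w with canonical? w
  ... | yes _ = w
  ... | no _  = - w

  canonical-square : ∀ w → canonical w * canonical w ≡ w * w
  canonical-square w with canonical? w
  ... | yes _ = refl
  ... | no _  = trans (sym (-‿distribˡ-* w (- w))) (trans (cong -_ (sym (-‿distribʳ-* w w))) (-‿involutive (w * w)))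

  canonical-canonical : w ≢ 0# → (∁ (_≡ 0#) ∩ Canonical) (canonical w)
  canonical-canonical {w} w≢0 with canonical? w
  ... | yes w<-w = w≢0 , w<-w
  ... | no w≮-w  = -‿nonzero w≢0 ,
    subst (λ v → from (- w) Fin.< from v) (sym (-‿involutive w)) (from-<-flip (-x≢x w≢0 ∘ sym) w≮-w)

  -- Junk value 0# on non-squares.
  √ : Carrier → Carrier
  √ x with isSquare? x
  ... | yes (w , _) = w
  ... | no _        = 0#

  √-square : IsSquare x → √ x * √ x ≡ x
  √-square {x} sq with isSquare? x
  ... | yes (_ , ww≡x) = ww≡x
  ... | no ¬sq         = contradiction sq ¬sq

  √-nonzero : QR x → √ x ≢ 0#
  √-nonzero (x≢0 , sq) √x≡0 = x≢0 (trans (sym (√-square sq)) (trans (cong (λ v → v * v) √x≡0) (R.zeroˡ 0#)))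

  count-canonical≡count-QR : count (nonzero? ∩? canonical?) ≡ count QR?
  count-canonical≡count-QR = ≤-antisym
    (count-≤-injection (nonzero? ∩? canonical?) QR? (λ x → x * x) (QR-square ∘ proj₁) squaring-injective)
    (count-≤-injection QR? (nonzero? ∩? canonical?) (canonical ∘ √) (canonical-canonical ∘ √-nonzero) root-injective)
    where
    open ≡-Reasoning
    squaring-injective : (∁ (_≡ 0#) ∩ Canonical) x → (∁ (_≡ 0#) ∩ Canonical) y → x * x ≡ y * y → x ≡ y
    squaring-injective {x} {y} (_ , x<-x) (_ , y<-y) xx≡yy with square-roots xx≡yy
    ... | inj₁ x≡y  = x≡y
    ... | inj₂ refl = contradiction (subst (λ v → from (- y) Fin.< from v) (-‿involutive y) x<-x) (Finₚ.<-asym y<-y)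
    root-injective : QR x → QR y → canonical (√ x) ≡ canonical (√ y) → x ≡ y
    root-injective {x} {y} (_ , x-square) (_ , y-square) eq = begin
      x                                     ≡⟨ √-square x-square ⟨
      √ x * √ x                             ≡⟨ canonical-square (√ x) ⟨
      canonical (√ x) * canonical (√ x)     ≡⟨ cong (λ v → v * v) eq ⟩
      canonical (√ y) * canonical (√ y)     ≡⟨ canonical-square (√ y) ⟩
      √ y * √ y                             ≡⟨ √-square y-square ⟩
      y                                     ∎

  count-nonzero≡2*count-QR : count nonzero? ≡ 2 Nat.* count QR?
  count-nonzero≡2*count-QR = trans (count-involution nonzero? -_ -‿nonzero -‿involutive -x≢x)
                                   (cong (2 Nat.*_) count-canonical≡count-QR)

  q≡1+2*count-QR : q ≡ suc (2 Nat.* count QR?)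
  q≡1+2*count-QR = trans q≡1+count-nonzero (cong suc count-nonzero≡2*count-QR)

  count-nonsquare≡count-QR : count (nonzero? ∩? ∁? isSquare?) ≡ count QR?
  count-nonsquare≡count-QR = +-cancelˡ-≡ (count QR?) _ _ (begin
    count QR? Nat.+ count (nonzero? ∩? ∁? isSquare?) ≡⟨ count-split nonzero? isSquare? ⟨
    count nonzero?                                   ≡⟨ count-nonzero≡2*count-QR ⟩
    2 Nat.* count QR?                                ≡⟨ cong (count QR? Nat.+_) (+-identityʳ (count QR?)) ⟩
    count QR? Nat.+ count QR?                        ∎)
    where open ≡-Reasoning

4t+3≡1+2[1+2t] : ∀ t → 4 Nat.* t Nat.+ 3 ≡ suc (2 Nat.* suc (2 Nat.* t))
4t+3≡1+2[1+2t] = solve-∀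

1+t≤4t+3 : ∀ t → suc t ≤ 4 Nat.* t Nat.+ 3
1+t≤4t+3 t = begin
  suc t            ≤⟨ s≤s (m≤n*m t 4) ⟩
  1 Nat.+ 4 Nat.* t ≡⟨ +-comm 1 (4 Nat.* t) ⟩
  4 Nat.* t Nat.+ 1 ≤⟨ +-monoʳ-≤ (4 Nat.* t) (s≤s z≤n) ⟩
  4 Nat.* t Nat.+ 3 ∎
  where open ≤-Reasoning

module ThreeModFour {q : ℕ} (F : FiniteField q) (t : ℕ) (q≡4t+3 : q ≡ 4 Nat.* t Nat.+ 3) where
  open FiniteField F
  open FiniteFieldProperties F
  open OddOrder F (suc (2 Nat.* t)) (trans q≡4t+3 (4t+3≡1+2[1+2t] t))
  open RingProperties R.ring using (-‿involutive; -‿distribˡ-*; -‿injective; -1*x≈-x; ⁻¹-anti-homo‿-; [y-z]x≈yx-zx)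

  private variable
    x : Carrier

  count-QR≡1+2t : count QR? ≡ suc (2 Nat.* t)
  count-QR≡1+2t = *-cancelˡ-≡ _ _ 2 (suc-injective (trans (sym q≡1+2*count-QR) (trans q≡4t+3 (4t+3≡1+2[1+2t] t))))

  -1-nonsquare : ¬ IsSquare (- 1#)
  -1-nonsquare (i , ii≡-1) = even≢odd (count (QR? ∩? precedes? (-_))) t
    (trans (sym (count-involution QR? -_ QR-neg -‿involutive (-x≢x ∘ proj₁))) count-QR≡1+2t)
    where
    QR-neg : QR x → QR (- x)
    QR-neg {x} qx = subst QR (-1*x≈-x x) (QR-* (-‿nonzero 1≢0 , i , ii≡-1) qx)

  QR⇒nonsquare-neg : QR x → ¬ IsSquare (- x)
  QR⇒nonsquare-neg {x} qx@(x≢0 , _) -x-square =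
    -1-nonsquare (proj₂ (subst QR -x*x⁻¹≡-1 (QR-* (-‿nonzero x≢0 , -x-square) (QR-⁻¹ qx))))
    where
    -x*x⁻¹≡-1 : - x * x ⁻¹ ≡ - 1#
    -x*x⁻¹≡-1 = trans (sym (-‿distribˡ-* x (x ⁻¹))) (cong -_ (*-inverseʳ x≢0))

  -- Negation maps QR injectively into the nonzero non-squares, which are equally many.
  nonsquare⇒QR-neg : x ≢ 0# → ¬ IsSquare x → QR (- x)
  nonsquare⇒QR-neg x≢0 ¬square =
    let y , qy , -y≡x = injection-onto QR? (nonzero? ∩? ∁? isSquare?) -_
                          (λ qy → -‿nonzero (proj₁ qy) , QR⇒nonsquare-neg qy) (λ _ _ → -‿injective)
                          (≤-reflexive count-nonsquare≡count-QR) (x≢0 , ¬square)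
    in subst QR (trans (sym (-‿involutive y)) (cong -_ -y≡x)) qy

  QR⊎QR-neg : x ≢ 0# → QR x ⊎ QR (- x)
  QR⊎QR-neg {x} x≢0 with isSquare? x
  ... | yes square  = inj₁ (x≢0 , square)
  ... | no ¬square = inj₂ (nonsquare⇒QR-neg x≢0 ¬square)

  Return : Pred Carrier 0ℓ
  Return z = QR (z - 1#) × QR (0# - z)

  return? : Decidable Return
  return? z = QR? (z - 1#) ×-dec QR? (0# - z)

  private
    Shifted Reflected : Pred Carrier 0ℓ
    Shifted z = QR (z - 1#)
    Reflected z = QR (1# - z)

    shifted? : Decidable Shifted
    shifted? z = QR? (z - 1#)

    reflected? : Decidable Reflected
    reflected? z = QR? (1# - z)

    A? : Decidable (QR ∩ Shifted)
    A? = QR? ∩? shifted?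

    B? : Decidable (QR ∩ Reflected)
    B? = QR? ∩? reflected?

  count-shifted≡count-QR : count shifted? ≡ count QR?
  count-shifted≡count-QR = count-∘-bijection QR? (_- 1#) (_+ 1#) [x+1]-1≡x [x-1]+1≡x
    where
    [x+1]-1≡x : ∀ x → (x + 1#) - 1# ≡ x
    [x+1]-1≡x x = trans (R.+-assoc x 1# (- 1#)) (trans (cong (x +_) (R.-‿inverseʳ 1#)) (R.+-identityʳ x))
    [x-1]+1≡x : ∀ x → (x - 1#) + 1# ≡ x
    [x-1]+1≡x x = trans (R.+-assoc x (- 1#) 1#) (trans (cong (x +_) (R.-‿inverseˡ 1#)) (R.+-identityʳ x))

  count-A≡count-B : count A? ≡ count B?
  count-A≡count-B = ≤-antisym (count-≤-injection A? B? _⁻¹ A⇒B⁻¹ (⁻¹-injectiveOn Shifted))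
                              (count-≤-injection B? A? _⁻¹ B⇒A⁻¹ (⁻¹-injectiveOn Reflected))
    where
    ⁻¹-injectiveOn : ∀ (P : Pred Carrier 0ℓ) {x y} → (QR ∩ P) x → (QR ∩ P) y → x ⁻¹ ≡ y ⁻¹ → x ≡ y
    ⁻¹-injectiveOn _ ((x≢0 , _) , _) ((y≢0 , _) , _) = ⁻¹-injective x≢0 y≢0
    A⇒B⁻¹ : (QR ∩ Shifted) x → (QR ∩ Reflected) (x ⁻¹)
    A⇒B⁻¹ {x} (qx@(x≢0 , _) , qx-1) = QR-⁻¹ qx , subst QR [x-1]x⁻¹≡1-x⁻¹ (QR-* qx-1 (QR-⁻¹ qx))
      where
      [x-1]x⁻¹≡1-x⁻¹ : (x - 1#) * x ⁻¹ ≡ 1# - (x ⁻¹)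
      [x-1]x⁻¹≡1-x⁻¹ = trans ([y-z]x≈yx-zx (x ⁻¹) x 1#) (cong₂ _-_ (*-inverseʳ x≢0) (R.*-identityˡ (x ⁻¹)))
    B⇒A⁻¹ : (QR ∩ Reflected) x → (QR ∩ Shifted) (x ⁻¹)
    B⇒A⁻¹ {x} (qx@(x≢0 , _) , q1-x) = QR-⁻¹ qx , subst QR [1-x]x⁻¹≡x⁻¹-1 (QR-* q1-x (QR-⁻¹ qx))
      where
      [1-x]x⁻¹≡x⁻¹-1 : (1# - x) * x ⁻¹ ≡ (x ⁻¹) - 1#
      [1-x]x⁻¹≡x⁻¹-1 = trans ([y-z]x≈yx-zx (x ⁻¹) 1# x) (cong₂ _-_ (R.*-identityˡ (x ⁻¹)) (*-inverseʳ x≢0))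

  count-QR-split : count QR? ≡ count A? Nat.+ suc (count B?)
  count-QR-split = begin
    count QR?                                              ≡⟨ count-split QR? shifted? ⟩
    count A? Nat.+ count X?                                ≡⟨ cong (count A? Nat.+_) (count-split X? (_≟ 1#)) ⟩
    count A? Nat.+ (count (X? ∩? (_≟ 1#)) Nat.+ count (X? ∩? ∁? (_≟ 1#)))
      ≡⟨ cong (count A? Nat.+_) (cong₂ Nat._+_ (count-singleton _ 1# (proj₂ , λ { refl → X1 , refl }))
                                               (count-cong _ B? (X≢1⇒B , B⇒X≢1))) ⟩
    count A? Nat.+ suc (count B?)                          ∎
    where
    open ≡-Reasoning
    X? = QR? ∩? ∁? shifted?
    X1 : (QR ∩ ∁ Shifted) 1#
    X1 = QR-1 , λ q0 → proj₁ q0 (R.-‿inverseʳ 1#)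
    X≢1⇒B : ((QR ∩ ∁ Shifted) ∩ ∁ (_≡ 1#)) x → (QR ∩ Reflected) x
    X≢1⇒B {x} ((qx , ¬qx-1) , x≢1) = qx , subst QR (⁻¹-anti-homo‿- x 1#) (nonsquare⇒QR-neg x-1≢0 (¬qx-1 ∘ (x-1≢0 ,_)))
      where
      x-1≢0 : x - 1# ≢ 0#
      x-1≢0 = x≢1 ∘ x-y≡0⇒x≡y
    B⇒X≢1 : (QR ∩ Reflected) x → ((QR ∩ ∁ Shifted) ∩ ∁ (_≡ 1#)) x
    B⇒X≢1 {x} (qx , q1-x@(1-x≢0 , 1-x-square)) =
      (qx , λ qx-1 → QR⇒nonsquare-neg qx-1 (subst IsSquare (sym (⁻¹-anti-homo‿- x 1#)) 1-x-square)) ,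
      λ { refl → 1-x≢0 (R.-‿inverseʳ 1#) }

  count-shifted-split : count shifted? ≡ count A? Nat.+ count return?
  count-shifted-split = trans (count-split shifted? QR?)
    (cong₂ Nat._+_ (count-cong _ A? ((λ (a , b) → b , a) , (λ (a , b) → b , a)))
                   (count-cong _ return? (T¬QR⇒Return , Return⇒T¬QR)))
    where
    T¬QR⇒Return : (Shifted ∩ ∁ QR) x → Return x
    T¬QR⇒Return {x} (qx-1 , ¬qx) = qx-1 , subst QR (sym (R.+-identityˡ (- x))) (nonsquare⇒QR-neg x≢0 (¬qx ∘ (x≢0 ,_)))
      where
      x≢0 : x ≢ 0#
      x≢0 refl = -1-nonsquare (subst IsSquare (R.+-identityˡ (- 1#)) (proj₂ qx-1))
    Return⇒T¬QR : Return x → (Shifted ∩ ∁ QR) x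
    Return⇒T¬QR {x} (qx-1 , (_ , 0-x-square)) = qx-1 , λ qx → QR⇒nonsquare-neg qx (subst IsSquare (R.+-identityˡ (- x)) 0-x-square)

  -- For a = #{z ∈ QR | z - 1 ∈ QR} = #{z ∈ QR | 1 - z ∈ QR}, splitting QR on z - 1 gives
  -- #QR = a + 1 + a, and splitting its translate QR + 1 on z gives #QR = a + #Return.
  count-return : count return? ≡ suc t
  count-return = trans (+-cancelˡ-≡ a _ _ a+r≡a+[1+a]) (cong suc a≡t)
    where
    open ≡-Reasoning
    a = count A?
    QR≡a+[1+a] : count QR? ≡ a Nat.+ suc a
    QR≡a+[1+a] = trans count-QR-split (cong (λ b → a Nat.+ suc b) (sym count-A≡count-B))
    a+r≡a+[1+a] : a Nat.+ count return? ≡ a Nat.+ suc a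
    a+r≡a+[1+a] = trans (sym count-shifted-split) (trans count-shifted≡count-QR QR≡a+[1+a])
    a≡t : a ≡ t
    a≡t = *-cancelˡ-≡ a t 2 (suc-injective (begin
      suc (2 Nat.* a)   ≡⟨ cong (λ n → suc (a Nat.+ n)) (+-identityʳ a) ⟩
      suc (a Nat.+ a)   ≡⟨ +-suc a a ⟨
      a Nat.+ suc a     ≡⟨ QR≡a+[1+a] ⟨
      count QR?         ≡⟨ count-QR≡1+2t ⟩
      suc (2 Nat.* t)   ∎))

module Paley {q : ℕ} (F : FiniteField q) (t : ℕ) (q≡4t+3 : q ≡ 4 Nat.* t Nat.+ 3) where
  open FiniteField F
  open FiniteFieldProperties F
  open ThreeModFour F t q≡4t+3
  open Visibility (PaleyArc F)
  open RingProperties R.ring using (⁻¹-anti-homo‿-; -‿+-comm; x[y-z]≈xy-xz; +-cancelˡ)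
  open CommutativeSemigroupProperties R.+-commutativeSemigroup using () renaming (interchange to +-interchange)
  open import Data.List.Membership.DecPropositional _≟_ using (_∈?_)

  private variable
    u v x y : Carrier
    S : List Carrier

  QR-antisym : QR (v - u) → ¬ QR (u - v)
  QR-antisym {v} {u} qr (_ , square) = QR⇒nonsquare-neg qr (subst IsSquare (sym (⁻¹-anti-homo‿- v u)) square)

  isTournament : IsTournament (PaleyArc F)
  isTournament = (λ v (v-v≢0 , _) → v-v≢0 (R.-‿inverseʳ v)) , total
    where
    total : ∀ u v → u ≢ v → (PaleyArc F u v × ¬ PaleyArc F v u) ⊎ (PaleyArc F v u × ¬ PaleyArc F u v)
    total u v u≢v with QR⊎QR-neg {v - u} (u≢v ∘ sym ∘ x-y≡0⇒x≡y)
    ... | inj₁ u→v  = inj₁ (u→v , QR-antisym u→v)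
    ... | inj₂ qr-neg = let v→u = subst QR (⁻¹-anti-homo‿- v u) qr-neg in inj₂ (v→u , QR-antisym v→u)

  affine-difference : ∀ x d u v → (x + d * v) - (x + d * u) ≡ d * (v - u)
  affine-difference x d u v = begin
    (x + d * v) - (x + d * u)           ≡⟨ cong ((x + d * v) +_) (-‿+-comm x (d * u)) ⟨
    (x + d * v) + (- x + - (d * u))     ≡⟨ +-interchange x (d * v) (- x) (- (d * u)) ⟩
    (x + - x) + ((d * v) - (d * u))     ≡⟨ cong (_+ ((d * v) - (d * u))) (R.-‿inverseʳ x) ⟩
    0# + ((d * v) - (d * u))            ≡⟨ R.+-identityˡ _ ⟩
    (d * v) - (d * u)                   ≡⟨ x[y-z]≈xy-xz d v u ⟨
    d * (v - u)                         ∎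
    where open ≡-Reasoning

  arc-affine : ∀ {d} → QR d → PaleyArc F u v → PaleyArc F (x + d * u) (x + d * v)
  arc-affine {u} {v} {x} {d} qd u→v = subst QR (sym (affine-difference x d u v)) (QR-* qd u→v)

  returns? : ∀ x y → Decidable (λ z → PaleyArc F y z × PaleyArc F z x)
  returns? x y z = QR? (z - y) ×-dec QR? (x - z)

  count-returns : PaleyArc F x y → suc t ≤ count (returns? x y)
  count-returns {x} {y} qd@(d≢0 , _) = subst (_≤ count (returns? x y)) count-return
    (count-≤-injection return? (returns? x y) (λ z → x + d * z) maps injective)
    where
    d = y - x
    x+d*1≡y : x + d * 1# ≡ y
    x+d*1≡y = trans (cong (x +_) (R.*-identityʳ d)) (trans (R.+-comm x d) (trans (R.+-assoc y (- x) x)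
                (trans (cong (y +_) (R.-‿inverseˡ x)) (R.+-identityʳ y))))
    x+d*0≡x : x + d * 0# ≡ x
    x+d*0≡x = trans (cong (x +_) (R.zeroʳ d)) (R.+-identityʳ x)
    maps : ∀ {z} → Return z → PaleyArc F y (x + d * z) × PaleyArc F (x + d * z) x
    maps {z} (1→z , z→0) = subst (λ w → PaleyArc F w (x + d * z)) x+d*1≡y (arc-affine qd 1→z) ,
                           subst (PaleyArc F (x + d * z)) x+d*0≡x (arc-affine qd z→0)
    injective : ∀ {z z′} → Return z → Return z′ → x + d * z ≡ x + d * z′ → z ≡ z′
    injective _ _ eq = *-cancelˡ d≢0 (+-cancelˡ x _ _ eq)

  return-outside : length S ≤ suc t → x ∈ S → PaleyArc F x y → ∃[ z ] ((PaleyArc F y z × PaleyArc F z x) × z ∉ S)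
  return-outside {S} {x} {y} |S|≤1+t x∈S x→y = count>0⇒∃ (returns? x y ∩? ∁? (_∈? S)) (+-cancelˡ-< inside 0 _ (begin-strict
    inside Nat.+ 0                                  ≡⟨ +-identityʳ inside ⟩
    inside                                          ≤⟨ count-≤-length (returns? x y ∩? (_∈? S)) inside⊆ ⟩
    length (filter (returns? x y) S)                <⟨ filter-notAll (returns? x y) S x-no-return ⟩
    length S                                        ≤⟨ |S|≤1+t ⟩
    suc t                                           ≤⟨ count-returns x→y ⟩
    count (returns? x y)                            ≡⟨ count-split (returns? x y) (_∈? S) ⟩
    inside Nat.+ count (returns? x y ∩? ∁? (_∈? S)) ∎))
    where
    open ≤-Reasoning
    inside = count (returns? x y ∩? (_∈? S))
    inside⊆ : ∀ {z} → (PaleyArc F y z × PaleyArc F z x) × z ∈ S → z ∈ filter (returns? x y) S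
    inside⊆ (ret , z∈S) = ∈-filter⁺ (returns? x y) z∈S ret
    x-no-return : Any (λ z → ¬ (PaleyArc F y z × PaleyArc F z x)) S
    x-no-return = lose x∈S λ (_ , x→x) → proj₁ isTournament x x→x

  ≤1+t⇒isMutualVisibilitySet : Unique S → length S ≤ suc t → IsMutualVisibilitySet (PaleyArc F) S
  ≤1+t⇒isMutualVisibilitySet {S} S-unique |S|≤1+t = isMutualVisibilitySet isTournament S-unique visible
    where
    visible : ∀ {x y} → x ∈ S → y ∈ S → PaleyArc F x y → VisiblePair S x y
    visible x∈S _ x→y =
      let z , (y→z , z→x) , z∉S = return-outside |S|≤1+t x∈S x→y
      in visible-via-2-path isTournament x→y y→z z→x z∉S

  μ≥k : ∀ {k} → k ≤ suc t → μ≥ (PaleyArc F) k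
  μ≥k {k} k≤1+t = take k elements ,
                  ≤1+t⇒isMutualVisibilitySet (take⁺ k elements-unique) (≤-trans (≤-reflexive length-S) k≤1+t) ,
                  ≤-reflexive (sym length-S)
    where
    k≤q : k ≤ length elements
    k≤q = ≤-trans k≤1+t (subst (suc t ≤_) (sym (trans length-elements q≡4t+3)) (1+t≤4t+3 t))
    length-S : length (take k elements) ≡ k
    length-S = trans (length-take k elements) (m≤n⇒m⊓n≡m k≤q)

open Nat using (_+_; _*_; _%_; _/_)

q≡4[q/4]+3 : ∀ {q} → q % 4 ≡ 3 → q ≡ 4 * (q / 4) + 3
q≡4[q/4]+3 {q} q%4≡3 = trans (m≡m%n+[m/n]*n q 4)
  (trans (cong (_+ (q / 4) * 4) q%4≡3) (trans (+-comm 3 _) (cong (_+ 3) (*-comm (q / 4) 4))))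

[4t+3]+5≡4[2+t] : ∀ t → (4 * t + 3) + 5 ≡ 4 * (2 + t)
[4t+3]+5≡4[2+t] = solve-∀

k≤1+t : ∀ {k t} → 4 * k < (4 * t + 3) + 5 → k ≤ suc t
k≤1+t {k} {t} 4k<4t+8 = ≤-pred (*-cancelˡ-< 4 k (2 + t) (subst (4 * k <_) ([4t+3]+5≡4[2+t] t) 4k<4t+8))

mainTheorem9 : ((k : ℕ) → 1 ≤ k →
    Σ ℕ λ n → Σ (Fin n → Fin n → Set) λ A → IsTournament A × μ≥ A k)
    ×
    ((k q : ℕ) → 1 ≤ k → q % 4 ≡ 3 → 4 * k < q + 5 → (F : FiniteField q) →
    μ≥ (PaleyArc F) k)
mainTheorem9 =
  (λ k _ → 2 + k , Arc k , isTournament k , μ≥k k) ,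
  λ k q _ q%4≡3 4k<q+5 F → let q≡4t+3 = q≡4[q/4]+3 q%4≡3 in
    Paley.μ≥k F (q / 4) q≡4t+3 (k≤1+t (subst (λ q → 4 * k < q + 5) q≡4t+3 4k<q+5))
  where open TransitiveWithReturnPath using (Arc; isTournament; μ≥k)
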